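{- Let $V$ and $V'$ be left vector spaces of finite dimensions $n$ and $n'$ over division rings $R$ and $R'$, respectively, and let $k\in\{2,\dots,n-2\}$, $k'\in\{2,\dots,n'-2\}$. For every embedding $f$ of $\Gamma_{k}(V)$ in $\Gamma_{k'}(V')$ exactly one of the following holds: (A) $f$ maps every star of $\Gamma_k(V)$ into a star of $\Gamma_{k'}(V')$ and every top of $\Gamma_k(V)$ into a top of $\Gamma_{k'}(V')$; (B) $f$ maps every star of $\Gamma_k(V)$ into a top of $\Gamma_{k'}(V')$ and every top of $\Gamma_k(V)$ into a star of $\Gamma_{k'}(V')$.
   Context: For a vector space $W$ of dimension $m$ and $1\le p\le m-1$, $\mathcal G_p(W)$ denotes the set of $p$-dimensional subspaces of $W$. The Grassmann graph $\Gamma_p(W)$ has vertex set $\mathcal G_p(W)$, two vertices being adjacent if their intersection is $(p-1)$-dimensional. For $1<p<m-1$, a star of $\Gamma_p(W)$ is a set $[S\rangle_p=\{X\in\mathcal G_p(W): S\subset X\}$ with $S\in\mathcal G_{p-1}(W)$, and a top is a set $\langle U]_p=\{X\in\mathcal G_p(W): X\subset U\}$ with $U\in\mathcal G_{p+1}(W)$; these are precisely the maximal cliques of $\Gamma_p(W)$. An embedding of a graph $\Gamma$ in a graph $\Gamma'$ is an injective map $f$ from the vertex set of $\Gamma$ to that of $\Gamma'$ such that two vertices $x,y$ are adjacent in $\Gamma$ if and only if $f(x),f(y)$ are adjacent in $\Gamma'$. -}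

module Defs where

open import Level using (Level; _⊔_) renaming (suc to lsuc)
open import Data.Nat using (ℕ; _∸_; _+_)
import Data.Nat as ℕ
open import Data.Fin using (Fin)
import Data.Fin as F
open import Data.Product using (Σ; ∃; _×_; _,_; proj₁)
open import Data.Unit.Polymorphic using (⊤)
open import Function using (_∘_)
open import Relation.Nullary using (¬_)
open import Algebra.Bundles using (Ring)
open import Algebra.Module.Bundles using (LeftModule)

record DivisionRing (c ℓ : Level) : Set (lsuc (c ⊔ ℓ)) where
  field
    ring : Ring c ℓ
  open Ring ring
  field
    0≉1     : ¬ (0# ≈ 1#)
    inverse : ∀ x → ¬ (x ≈ 0#) → Σ Carrier λ y → (y * x ≈ 1#) × (x * y ≈ 1#)

module LinAlg {c ℓ m ℓm : Level} (R : DivisionRing c ℓ)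
              (V : LeftModule (DivisionRing.ring R) m ℓm) where

  open Ring (DivisionRing.ring R) using (Carrier; _≈_; 0#)
  open LeftModule V

  ℓs : Level
  ℓs = c ⊔ ℓ ⊔ m ⊔ ℓm

  lin : ∀ {p} → (Fin p → Carrier) → (Fin p → Carrierᴹ) → Carrierᴹ
  lin {ℕ.zero}  r v = 0ᴹ
  lin {ℕ.suc p} r v = (r F.zero *ₗ v F.zero) +ᴹ lin (r ∘ F.suc) (v ∘ F.suc)

  LinIndep : ∀ {p} → (Fin p → Carrierᴹ) → Set (c ⊔ ℓ ⊔ ℓm)
  LinIndep {p} v = ∀ (r : Fin p → Carrier) → lin r v ≈ᴹ 0ᴹ → ∀ i → r i ≈ 0#

  record Subspace : Set (lsuc ℓs) where
    field
      _∋_   : Carrierᴹ → Set ℓs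
      resp  : ∀ {x y} → x ≈ᴹ y → _∋_ x → _∋_ y
      ∋0    : _∋_ 0ᴹ
      ∋+    : ∀ {x y} → _∋_ x → _∋_ y → _∋_ (x +ᴹ y)
      ∋*    : ∀ a {x} → _∋_ x → _∋_ (a *ₗ x)
  open Subspace public

  whole : Subspace
  whole = record { _∋_ = λ _ → ⊤ ; resp = λ _ _ → _ ; ∋0 = _
                 ; ∋+ = λ _ _ → _ ; ∋* = λ _ _ → _ }

  _∩_ : Subspace → Subspace → Subspace
  X ∩ Y = record
    { _∋_ = λ x → (X ∋ x) × (Y ∋ x)
    ; resp = λ e (p , q) → resp X e p , resp Y e q
    ; ∋0 = ∋0 X , ∋0 Y
    ; ∋+ = λ (p , q) (p' , q') → ∋+ X p p' , ∋+ Y q q'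
    ; ∋* = λ a (p , q) → ∋* X a p , ∋* Y a q }

  _⊆_ : Subspace → Subspace → Set (m ⊔ ℓs)
  X ⊆ Y = ∀ x → X ∋ x → Y ∋ x

  _≐_ : Subspace → Subspace → Set (m ⊔ ℓs)
  X ≐ Y = (X ⊆ Y) × (Y ⊆ X)

  HasDim : Subspace → ℕ → Set ℓs
  HasDim X p = Σ (Fin p → Carrierᴹ) λ v →
                 (∀ i → X ∋ v i) × LinIndep v ×
                 (∀ x → X ∋ x → Σ (Fin p → Carrier) λ r → lin r v ≈ᴹ x)

  DimIs : ℕ → Set ℓs
  DimIs n = HasDim whole n

  𝒢 : ℕ → Set (lsuc ℓs)
  𝒢 p = Σ Subspace λ X → HasDim X p

  Adj : ∀ p → 𝒢 p → 𝒢 p → Set ℓs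
  Adj p X Y = HasDim (proj₁ X ∩ proj₁ Y) (p ∸ 1)

module _ {c ℓ m ℓm c' ℓ' m' ℓm' : Level}
         (R : DivisionRing c ℓ) (V : LeftModule (DivisionRing.ring R) m ℓm)
         (R' : DivisionRing c' ℓ') (V' : LeftModule (DivisionRing.ring R') m' ℓm')
         (k k' : ℕ) where

  private
    module A = LinAlg R V
    module B = LinAlg R' V'

  -- f is an embedding of Γ_k(V) in Γ_k'(V'): a well-defined, injective map on
  -- vertices (vertices are subspaces up to equality ≐) such that
  -- X,Y adjacent iff f X, f Y adjacent.
  record IsEmbedding (f : A.𝒢 k → B.𝒢 k') : Set (A.ℓs ⊔ B.ℓs ⊔ lsuc A.ℓs) where
    field
      well-defined : ∀ X Y → proj₁ X A.≐ proj₁ Y → proj₁ (f X) B.≐ proj₁ (f Y)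
      injective    : ∀ X Y → proj₁ (f X) B.≐ proj₁ (f Y) → proj₁ X A.≐ proj₁ Y
      adj→adj      : ∀ X Y → A.Adj k X Y → B.Adj k' (f X) (f Y)
      adj←adj      : ∀ X Y → B.Adj k' (f X) (f Y) → A.Adj k X Y

  StarsIntoStars : (A.𝒢 k → B.𝒢 k') → Set (lsuc A.ℓs ⊔ lsuc B.ℓs)
  StarsIntoStars f = ∀ (S : A.𝒢 (k ∸ 1)) → Σ (B.𝒢 (k' ∸ 1)) λ S' →
    ∀ (X : A.𝒢 k) → proj₁ S A.⊆ proj₁ X → proj₁ S' B.⊆ proj₁ (f X)

  StarsIntoTops : (A.𝒢 k → B.𝒢 k') → Set (lsuc A.ℓs ⊔ lsuc B.ℓs)
  StarsIntoTops f = ∀ (S : A.𝒢 (k ∸ 1)) → Σ (B.𝒢 (k' + 1)) λ U' →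
    ∀ (X : A.𝒢 k) → proj₁ S A.⊆ proj₁ X → proj₁ (f X) B.⊆ proj₁ U'

  TopsIntoTops : (A.𝒢 k → B.𝒢 k') → Set (lsuc A.ℓs ⊔ lsuc B.ℓs)
  TopsIntoTops f = ∀ (U : A.𝒢 (k + 1)) → Σ (B.𝒢 (k' + 1)) λ U' →
    ∀ (X : A.𝒢 k) → proj₁ X A.⊆ proj₁ U → proj₁ (f X) B.⊆ proj₁ U'

  TopsIntoStars : (A.𝒢 k → B.𝒢 k') → Set (lsuc A.ℓs ⊔ lsuc B.ℓs)
  TopsIntoStars f = ∀ (U : A.𝒢 (k + 1)) → Σ (B.𝒢 (k' ∸ 1)) λ S' →
    ∀ (X : A.𝒢 k) → proj₁ X A.⊆ proj₁ U → proj₁ S' B.⊆ proj₁ (f X)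

  CaseA : (A.𝒢 k → B.𝒢 k') → Set (lsuc A.ℓs ⊔ lsuc B.ℓs)
  CaseA f = StarsIntoStars f × TopsIntoTops f

  CaseB : (A.𝒢 k → B.𝒢 k') → Set (lsuc A.ℓs ⊔ lsuc B.ℓs)
  CaseB f = StarsIntoTops f × TopsIntoStars f

module Submission where

-- A star [S⟩ and a top ⟨U] with S ⊆ U never go to the same kind,
--    so all stars inside one top behave alike; exchanging basis vectors one
--    at a time links any two (k-1)-spaces through common tops, so all stars,
--    and hence all tops, behave alike.

open import Defs
open import Level using (Level; Lift; lift; lower; _⊔_) renaming (suc to lsuc)
open import Data.Nat using (ℕ; zero; suc; _≤_; _<_; _+_; z≤n; s≤s)
open import Data.Nat.Properties
  using (≤-refl; ≤-trans; ≤-reflexive; ≤-antisym; ≤-pred; <⇒≤; <⇒≱; <-irrefl;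
         ≤∧≢⇒<; m≤n⇒m≤1+n; m≤n⇒m<n∨m≡n; n≤1+n; n<1+n; 1+n≢n; m≤m+n; m≤n+m)
import Data.Nat.Properties as ℕP
open import Data.Fin using (Fin; zero; suc; punchIn; punchOut; toℕ; fromℕ<)
open import Data.Fin.Properties
  using (_≟_; punchInᵢ≢i; punchIn-punchOut; toℕ<n; toℕ-fromℕ<; toℕ-injective)
open import Data.Vec.Functional using (_∷_; tail; insertAt)
open import Data.Vec.Functional.Properties using (insertAt-lookup; insertAt-punchIn)
open import Data.Product using (Σ; _×_; _,_; proj₁; proj₂; map₂; curry)
open import Data.Sum using (_⊎_; inj₁; inj₂)
import Data.Sum as Sum
open import Data.Empty using (⊥; ⊥-elim)
open import Function using (_∘_; id)
open import Relation.Nullary using (¬_; Dec; yes; no)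
open import Relation.Nullary.Decidable using (decidable-stable)
import Relation.Binary.PropositionalEquality as P
open P using (_≡_; _≢_)
open import Axiom.ExcludedMiddle using (ExcludedMiddle)
open import Algebra.Bundles using (Ring; CommutativeMonoid)
import Algebra.Properties.Ring as RingProperties
import Algebra.Properties.CommutativeSemigroup as CommutativeSemigroupProperties
open import Algebra.Module.Bundles using (LeftModule)
import Algebra.Module.Properties.LeftModule as LeftModuleProperties

punchIn-cover : ∀ {q} (j i : Fin (suc q)) → i ≡ j ⊎ Σ (Fin q) λ i′ → punchIn j i′ ≡ i
punchIn-cover j i with j ≟ i
... | yes j≡i = inj₁ (P.sym j≡i)
... | no j≢i = inj₂ (punchOut j≢i , punchIn-punchOut j≢i)

module LinearAlgebra {c ℓ m ℓm : Level} (em : ∀ {a} → ExcludedMiddle a)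
         (DR : DivisionRing c ℓ) (V : LeftModule (DivisionRing.ring DR) m ℓm) where
  open DivisionRing DR using (0≉1; inverse)
  open Ring (DivisionRing.ring DR) hiding (zero) renaming (Carrier to K; _+_ to _+ₖ_)
  open RingProperties (DivisionRing.ring DR) using (-‿distribˡ-*)
  open LeftModule V
  open LeftModuleProperties V using (inverseˡ-uniqueᴹ; inverseʳ-uniqueᴹ)
  open CommutativeSemigroupProperties
         (CommutativeMonoid.commutativeSemigroup +ᴹ-commutativeMonoid)
         using (interchange; x∙yz≈y∙xz)
  open LinAlg DR V
  open import Relation.Binary.Reasoning.Setoid ≈ᴹ-setoid

  decide : ∀ {a} (Q : Set a) → Dec Q
  decide Q = em

  ¬¬-elim : ∀ {a} {Q : Set a} → ¬ ¬ Q → Q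
  ¬¬-elim = decidable-stable em

  ⊈-witness : {X Y : Subspace} → ¬ (X ⊆ Y) → Σ Carrierᴹ λ x → X ∋ x × ¬ (Y ∋ x)
  ⊈-witness X⊈Y = ¬¬-elim λ none → X⊈Y λ x x∈X → ¬¬-elim λ x∉Y → none (x , x∈X , x∉Y)

  scale-neg : ∀ a x → (- a) *ₗ x ≈ᴹ -ᴹ (a *ₗ x)
  scale-neg a x = inverseʳ-uniqueᴹ (a *ₗ x) ((- a) *ₗ x) (begin
    a *ₗ x +ᴹ (- a) *ₗ x  ≈⟨ *ₗ-distribʳ x a (- a) ⟨
    (a +ₖ - a) *ₗ x       ≈⟨ *ₗ-congʳ (-‿inverseʳ a) ⟩
    0# *ₗ x               ≈⟨ *ₗ-zeroˡ x ⟩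
    0ᴹ                    ∎)

  scale-zero : ∀ {a} x → a ≈ 0# → a *ₗ x ≈ᴹ 0ᴹ
  scale-zero x a≈0 = ≈ᴹ-trans (*ₗ-congʳ a≈0) (*ₗ-zeroˡ x)

  unscale : ∀ {a} x y → ¬ (a ≈ 0#) → a *ₗ x ≈ᴹ y → Σ K λ b → x ≈ᴹ b *ₗ y
  unscale {a} x y a≉0 ax≈y with inverse a a≉0
  ... | b , ba≈1 , _ = b , (begin
    x              ≈⟨ *ₗ-identityˡ x ⟨
    1# *ₗ x        ≈⟨ *ₗ-congʳ ba≈1 ⟨
    (b * a) *ₗ x   ≈⟨ *ₗ-assoc b a x ⟩
    b *ₗ (a *ₗ x)  ≈⟨ *ₗ-congˡ ax≈y ⟩
    b *ₗ y         ∎)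

  -1≉0 : ¬ (- 1# ≈ 0#)
  -1≉0 -1≈0 = 0≉1 (sym (trans (sym (+-identityʳ 1#)) (trans (+-congˡ (sym -1≈0)) (-‿inverseʳ 1#))))

  lin-congˡ : ∀ {p} {r s : Fin p → K} (v : Fin p → Carrierᴹ) → (∀ i → r i ≈ s i) → lin r v ≈ᴹ lin s v
  lin-congˡ {zero}  v r≈s = ≈ᴹ-refl
  lin-congˡ {suc p} v r≈s = +ᴹ-cong (*ₗ-congʳ (r≈s zero)) (lin-congˡ (tail v) (r≈s ∘ suc))

  lin-congʳ : ∀ {p} (r : Fin p → K) {v w : Fin p → Carrierᴹ} → (∀ i → v i ≈ᴹ w i) → lin r v ≈ᴹ lin r w
  lin-congʳ {zero}  r v≈w = ≈ᴹ-refl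
  lin-congʳ {suc p} r v≈w = +ᴹ-cong (*ₗ-congˡ (v≈w zero)) (lin-congʳ (tail r) (v≈w ∘ suc))

  lin-zero : ∀ {p} {r : Fin p → K} (v : Fin p → Carrierᴹ) → (∀ i → r i ≈ 0#) → lin r v ≈ᴹ 0ᴹ
  lin-zero {zero}  v r≈0 = ≈ᴹ-refl
  lin-zero {suc p} v r≈0 =
    ≈ᴹ-trans (+ᴹ-cong (scale-zero (v zero) (r≈0 zero)) (lin-zero (tail v) (r≈0 ∘ suc))) (+ᴹ-identityˡ 0ᴹ)

  lin-+ : ∀ {p} (r s : Fin p → K) (v : Fin p → Carrierᴹ) → lin (λ i → r i +ₖ s i) v ≈ᴹ lin r v +ᴹ lin s v
  lin-+ {zero}  r s v = ≈ᴹ-sym (+ᴹ-identityˡ 0ᴹ)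
  lin-+ {suc p} r s v = begin
    (r zero +ₖ s zero) *ₗ v zero +ᴹ lin (λ i → r (suc i) +ₖ s (suc i)) (tail v)
      ≈⟨ +ᴹ-cong (*ₗ-distribʳ (v zero) (r zero) (s zero)) (lin-+ (tail r) (tail s) (tail v)) ⟩
    (r zero *ₗ v zero +ᴹ s zero *ₗ v zero) +ᴹ (lin (tail r) (tail v) +ᴹ lin (tail s) (tail v))
      ≈⟨ interchange _ _ _ _ ⟩
    lin r v +ᴹ lin s v ∎

  lin-* : ∀ {p} a (r : Fin p → K) (v : Fin p → Carrierᴹ) → lin (λ i → a * r i) v ≈ᴹ a *ₗ lin r v
  lin-* {zero}  a r v = ≈ᴹ-sym (*ₗ-zeroʳ a)
  lin-* {suc p} a r v = begin
    (a * r zero) *ₗ v zero +ᴹ lin (λ i → a * r (suc i)) (tail v)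
      ≈⟨ +ᴹ-cong (*ₗ-assoc a (r zero) (v zero)) (lin-* a (tail r) (tail v)) ⟩
    a *ₗ (r zero *ₗ v zero) +ᴹ a *ₗ lin (tail r) (tail v)
      ≈⟨ *ₗ-distribˡ a _ _ ⟨
    a *ₗ lin r v ∎

  unit : ∀ {p} → Fin p → Fin p → K
  unit zero    zero    = 1#
  unit zero    (suc i) = 0#
  unit (suc j) zero    = 0#
  unit (suc j) (suc i) = unit j i

  lin-unit : ∀ {p} (j : Fin p) (v : Fin p → Carrierᴹ) → lin (unit j) v ≈ᴹ v j
  lin-unit zero v =
    ≈ᴹ-trans (+ᴹ-cong (*ₗ-identityˡ (v zero)) (lin-zero (tail v) (λ _ → refl))) (+ᴹ-identityʳ (v zero))
  lin-unit (suc j) v = ≈ᴹ-trans (+ᴹ-cong (*ₗ-zeroˡ (v zero)) (lin-unit j (tail v))) (+ᴹ-identityˡ _)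

  lin∈ : ∀ {p} (X : Subspace) (r : Fin p → K) (v : Fin p → Carrierᴹ) → (∀ i → X ∋ v i) → X ∋ lin r v
  lin∈ {zero}  X r v v∈X = ∋0 X
  lin∈ {suc p} X r v v∈X = ∋+ X (∋* X (r zero) (v∈X zero)) (lin∈ X (tail r) (tail v) (v∈X ∘ suc))

  lin-split : ∀ {q} (j : Fin (suc q)) (r : Fin (suc q) → K) (v : Fin (suc q) → Carrierᴹ) →
              lin r v ≈ᴹ r j *ₗ v j +ᴹ lin (r ∘ punchIn j) (v ∘ punchIn j)
  lin-split zero r v = ≈ᴹ-refl
  lin-split {suc q} (suc j) r v = ≈ᴹ-trans (+ᴹ-congˡ (lin-split j (tail r) (tail v))) (x∙yz≈y∙xz _ _ _)

  lin-insertAt : ∀ {q} (j : Fin (suc q)) γ (r : Fin q → K) (v : Fin (suc q) → Carrierᴹ) →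
                 lin (insertAt r j γ) v ≈ᴹ γ *ₗ v j +ᴹ lin r (v ∘ punchIn j)
  lin-insertAt j γ r v = ≈ᴹ-trans (lin-split j (insertAt r j γ) v)
    (+ᴹ-cong (*ₗ-congʳ (reflexive (insertAt-lookup r j γ)))
             (lin-congˡ (v ∘ punchIn j) (reflexive ∘ insertAt-punchIn r j γ)))

  scalarSum : ∀ {p} → (Fin p → K) → K
  scalarSum {zero}  s = 0#
  scalarSum {suc p} s = s zero +ₖ scalarSum (tail s)

  lin-translate : ∀ {p} (r b : Fin p → K) (v : Fin p → Carrierᴹ) x →
                  lin r (λ i → v i +ᴹ b i *ₗ x) ≈ᴹ lin r v +ᴹ scalarSum (λ i → r i * b i) *ₗ x
  lin-translate {zero} r b v x = ≈ᴹ-sym (≈ᴹ-trans (+ᴹ-congˡ (*ₗ-zeroˡ x)) (+ᴹ-identityˡ 0ᴹ))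
  lin-translate {suc p} r b v x = begin
    r zero *ₗ (v zero +ᴹ b zero *ₗ x) +ᴹ lin (tail r) (λ i → v (suc i) +ᴹ b (suc i) *ₗ x)
      ≈⟨ +ᴹ-cong (≈ᴹ-trans (*ₗ-distribˡ (r zero) _ _) (+ᴹ-congˡ (≈ᴹ-sym (*ₗ-assoc _ _ _))))
                 (lin-translate (tail r) (tail b) (tail v) x) ⟩
    (r zero *ₗ v zero +ᴹ (r zero * b zero) *ₗ x) +ᴹ (lin (tail r) (tail v) +ᴹ scalarSum (λ i → r (suc i) * b (suc i)) *ₗ x)
      ≈⟨ interchange _ _ _ _ ⟩
    lin r v +ᴹ ((r zero * b zero) *ₗ x +ᴹ scalarSum (λ i → r (suc i) * b (suc i)) *ₗ x)
      ≈⟨ +ᴹ-congˡ (*ₗ-distribʳ x _ _) ⟨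
    lin r v +ᴹ scalarSum (λ i → r i * b i) *ₗ x ∎

  Span : ∀ {p} → (Fin p → Carrierᴹ) → Subspace
  Span {p} v = record
    { _∋_  = λ x → Lift ℓs (Σ (Fin p → K) λ r → lin r v ≈ᴹ x)
    ; resp = λ { x≈y (lift (r , e)) → lift (r , ≈ᴹ-trans e x≈y) }
    ; ∋0   = lift ((λ _ → 0#) , lin-zero v (λ _ → refl))
    ; ∋+   = λ { (lift (r , e)) (lift (s , e′)) →
                 lift ((λ i → r i +ₖ s i) , ≈ᴹ-trans (lin-+ r s v) (+ᴹ-cong e e′)) }
    ; ∋*   = λ { a (lift (r , e)) → lift ((λ i → a * r i) , ≈ᴹ-trans (lin-* a r v) (*ₗ-congˡ e)) } }

  span∋ : ∀ {p} (v : Fin p → Carrierᴹ) i → Span v ∋ v i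
  span∋ v i = lift (unit i , lin-unit i v)

  span⊆ : ∀ {p} (v : Fin p → Carrierᴹ) (X : Subspace) → (∀ i → X ∋ v i) → Span v ⊆ X
  span⊆ v X v∈X x (lift (r , e)) = resp X e (lin∈ X r v v∈X)

  ∷-∈ : ∀ {p} (X : Subspace) {x} {v : Fin p → Carrierᴹ} → X ∋ x → (∀ i → X ∋ v i) → ∀ i → X ∋ (x ∷ v) i
  ∷-∈ X x∈X v∈X zero    = x∈X
  ∷-∈ X x∈X v∈X (suc i) = v∈X i

  insertAt-∈ : ∀ {q} (X : Subspace) (j : Fin (suc q)) {r : Fin q → Carrierᴹ} {s} → (∀ i → X ∋ r i) → X ∋ s →
               ∀ i → X ∋ insertAt r j s i
  insertAt-∈ X j {r} {s} r∈X s∈X i with punchIn-cover j i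
  ... | inj₁ P.refl = resp X (≈ᴹ-reflexive (P.sym (insertAt-lookup r j s))) s∈X
  ... | inj₂ (i′ , P.refl) = resp X (≈ᴹ-reflexive (P.sym (insertAt-punchIn r j s i′))) (r∈X i′)

  ∋-neg : (X : Subspace) {x : Carrierᴹ} → X ∋ x → X ∋ (-ᴹ x)
  ∋-neg X {x} x∈X = resp X (≈ᴹ-trans (scale-neg 1# x) (-ᴹ‿cong (*ₗ-identityˡ x))) (∋* X (- 1#) x∈X)

  ∋-cancel : (X : Subspace) {x y : Carrierᴹ} → X ∋ (x +ᴹ y) → X ∋ y → X ∋ x
  ∋-cancel X {x} {y} x+y∈X y∈X = resp X (begin
    (x +ᴹ y) +ᴹ -ᴹ y  ≈⟨ +ᴹ-assoc x y (-ᴹ y) ⟩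
    x +ᴹ (y +ᴹ -ᴹ y)  ≈⟨ +ᴹ-congˡ (-ᴹ‿inverseʳ y) ⟩
    x +ᴹ 0ᴹ           ≈⟨ +ᴹ-identityʳ x ⟩
    x                 ∎) (∋+ X x+y∈X (∋-neg X y∈X))

  ∋-unscale : (X : Subspace) {a : K} {x : Carrierᴹ} → ¬ (a ≈ 0#) → X ∋ (a *ₗ x) → X ∋ x
  ∋-unscale X {x = x} a≉0 ax∈X with unscale x _ a≉0 ≈ᴹ-refl
  ... | b , x≈b·ax = resp X (≈ᴹ-sym x≈b·ax) (∋* X b ax∈X)

  -- If S ⊆ U and y ∉ U, a vector of U in the span of y and of vectors of S
  -- lies in S: its y-coefficient must vanish.
  cone-meet : ∀ {p} (S U : Subspace) (w : Fin p → Carrierᴹ) → (∀ i → S ∋ w i) → S ⊆ U →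
              ∀ {y z} → ¬ (U ∋ y) → Span (y ∷ w) ∋ z → U ∋ z → S ∋ z
  cone-meet S U w w∈S S⊆U {y} y∉U (lift (r , e)) z∈U with decide (r zero ≈ 0#)
  ... | yes r₀≈0 = resp S (≈ᴹ-trans (≈ᴹ-sym (≈ᴹ-trans (+ᴹ-congʳ (scale-zero y r₀≈0)) (+ᴹ-identityˡ _))) e)
                          (lin∈ S (tail r) w w∈S)
  ... | no r₀≉0 = ⊥-elim (y∉U (∋-unscale U r₀≉0
                     (∋-cancel U (resp U (≈ᴹ-sym e) z∈U) (S⊆U _ (lin∈ S (tail r) w w∈S)))))

  indep-extend : ∀ {q} (j : Fin (suc q)) (u : Fin (suc q) → Carrierᴹ) → LinIndep (u ∘ punchIn j) →
                 ¬ (Span (u ∘ punchIn j) ∋ u j) → LinIndep u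
  indep-extend j u ind uj∉ r lin≈0 i with decide (r j ≈ 0#)
  ... | no rj≉0 = ⊥-elim (uj∉ (∋-unscale (Span (u ∘ punchIn j)) rj≉0
                     (resp (Span (u ∘ punchIn j)) (≈ᴹ-sym rest≈-ruj) (∋-neg (Span (u ∘ punchIn j)) (lift (_ , ≈ᴹ-refl))))))
    where
    rest≈-ruj : r j *ₗ u j ≈ᴹ -ᴹ lin (r ∘ punchIn j) (u ∘ punchIn j)
    rest≈-ruj = inverseˡ-uniqueᴹ _ _ (≈ᴹ-trans (≈ᴹ-sym (lin-split j r u)) lin≈0)
  ... | yes rj≈0 with punchIn-cover j i
  ...   | inj₁ P.refl = rj≈0
  ...   | inj₂ (i′ , P.refl) = ind (r ∘ punchIn j) rest≈0 i′
    where
    rest≈0 : lin (r ∘ punchIn j) (u ∘ punchIn j) ≈ᴹ 0ᴹ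
    rest≈0 = ≈ᴹ-trans (≈ᴹ-sym (+ᴹ-identityˡ _))
               (≈ᴹ-trans (+ᴹ-congʳ (≈ᴹ-sym (scale-zero (u j) rj≈0))) (≈ᴹ-trans (≈ᴹ-sym (lin-split j r u)) lin≈0))

  indep-∷ : ∀ {p} {w : Fin p → Carrierᴹ} {x} → LinIndep w → ¬ (Span w ∋ x) → LinIndep (x ∷ w)
  indep-∷ {w = w} {x} = indep-extend zero (x ∷ w)

  indep-remove : ∀ {q} (j : Fin (suc q)) {u : Fin (suc q) → Carrierᴹ} → LinIndep u → LinIndep (u ∘ punchIn j)
  indep-remove j {u} ind r lin≈0 i = trans (reflexive (P.sym (insertAt-punchIn r j 0# i)))
    (ind (insertAt r j 0#) (≈ᴹ-trans (lin-insertAt j 0# r u)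
      (≈ᴹ-trans (+ᴹ-congʳ (*ₗ-zeroˡ _)) (≈ᴹ-trans (+ᴹ-identityˡ _) lin≈0))) (punchIn j i))

  indep-∉ : ∀ {q} (j : Fin (suc q)) {u : Fin (suc q) → Carrierᴹ} → LinIndep u → ¬ (Span (u ∘ punchIn j) ∋ u j)
  indep-∉ j {u} ind (lift (r , e)) =
    -1≉0 (trans (reflexive (P.sym (insertAt-lookup r j (- 1#)))) (ind (insertAt r j (- 1#)) lin≈0 j))
    where
    lin≈0 : lin (insertAt r j (- 1#)) u ≈ᴹ 0ᴹ
    lin≈0 = ≈ᴹ-trans (lin-insertAt j (- 1#) r u)
      (≈ᴹ-trans (+ᴹ-cong (≈ᴹ-trans (scale-neg 1# (u j)) (-ᴹ‿cong (*ₗ-identityˡ (u j)))) e) (-ᴹ‿inverseˡ (u j)))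

  indep-insertAt : ∀ {q} (j : Fin (suc q)) {r : Fin q → Carrierᴹ} {s} → LinIndep r → ¬ (Span r ∋ s) →
                   LinIndep (insertAt r j s)
  indep-insertAt j {r} {s} ind s∉ = indep-extend j (insertAt r j s) ind′ s∉′
    where
    same : ∀ i → r i ≈ᴹ insertAt r j s (punchIn j i)
    same i = ≈ᴹ-reflexive (P.sym (insertAt-punchIn r j s i))
    ind′ : LinIndep (insertAt r j s ∘ punchIn j)
    ind′ c e = ind c (≈ᴹ-trans (lin-congʳ c same) e)
    s∉′ : ¬ (Span (insertAt r j s ∘ punchIn j) ∋ insertAt r j s j)
    s∉′ (lift (c , e)) =
      s∉ (lift (c , ≈ᴹ-trans (lin-congʳ c same) (≈ᴹ-trans e (≈ᴹ-reflexive (insertAt-lookup r j s)))))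

  shear-indep : ∀ {q} (j : Fin (suc q)) (β : Fin q → K) (w : Fin (suc q) → Carrierᴹ) →
                LinIndep w → LinIndep (λ i → w (punchIn j i) +ᴹ β i *ₗ w j)
  shear-indep j β w ind r lin≈0 i =
    trans (reflexive (P.sym (insertAt-punchIn r j γ i))) (ind (insertAt r j γ) combination≈0 (punchIn j i))
    where
    γ = scalarSum (λ i → r i * β i)
    combination≈0 : lin (insertAt r j γ) w ≈ᴹ 0ᴹ
    combination≈0 = begin
      lin (insertAt r j γ) w                         ≈⟨ lin-insertAt j γ r w ⟩
      γ *ₗ w j +ᴹ lin r (w ∘ punchIn j)              ≈⟨ +ᴹ-comm _ _ ⟩
      lin r (w ∘ punchIn j) +ᴹ γ *ₗ w j              ≈⟨ lin-translate r β (w ∘ punchIn j) (w j) ⟨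
      lin r (λ i → w (punchIn j i) +ᴹ β i *ₗ w j)    ≈⟨ lin≈0 ⟩
      0ᴹ                                             ∎

  -- Gaussian elimination: if each w j is a combination of v (coefficients
  -- cf j) and w j₀ has a nonzero coefficient on v 0, then subtracting
  -- multiples of w j₀ from the other w j removes v 0 from their combinations.
  eliminate-head : ∀ {p q} (v : Fin (suc p) → Carrierᴹ) (w : Fin (suc q) → Carrierᴹ)
                   (cf : Fin (suc q) → Fin (suc p) → K) → (∀ j → lin (cf j) v ≈ᴹ w j) →
                   (j₀ : Fin (suc q)) → ¬ (cf j₀ zero ≈ 0#) →
                   Σ (Fin q → K) λ β → ∀ i → Σ (Fin p → K) λ c →
                     lin c (tail v) ≈ᴹ w (punchIn j₀ i) +ᴹ β i *ₗ w j₀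
  eliminate-head {p} {q} v w cf lin≈w j₀ a≉0 with inverse (cf j₀ zero) a≉0
  ... | a⁻¹ , a⁻¹a≈1 , _ = β , λ i → reduced i , combination i
    where
    a = cf j₀ zero
    β : Fin q → K
    β i = - (cf (punchIn j₀ i) zero * a⁻¹)
    reduced : Fin q → Fin p → K
    reduced i t = cf (punchIn j₀ i) (suc t) +ₖ β i * cf j₀ (suc t)
    head-cancels : ∀ i → cf (punchIn j₀ i) zero +ₖ β i * a ≈ 0#
    head-cancels i = let x = cf (punchIn j₀ i) zero in
      trans (+-congˡ (trans (sym (-‿distribˡ-* (x * a⁻¹) a))
                            (-‿cong (trans (*-assoc x a⁻¹ a) (trans (*-congˡ a⁻¹a≈1) (*-identityʳ x))))))
            (-‿inverseʳ x)
    combination : ∀ i → lin (reduced i) (tail v) ≈ᴹ w (punchIn j₀ i) +ᴹ β i *ₗ w j₀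
    combination i = begin
      lin (reduced i) (tail v)
        ≈⟨ ≈ᴹ-trans (lin-+ _ _ (tail v)) (+ᴹ-congˡ (lin-* (β i) _ (tail v))) ⟩
      Lᵢ +ᴹ β i *ₗ L₀
        ≈⟨ +ᴹ-identityˡ _ ⟨
      0ᴹ +ᴹ (Lᵢ +ᴹ β i *ₗ L₀)
        ≈⟨ +ᴹ-congʳ (≈ᴹ-sym (scale-zero (v zero) (head-cancels i))) ⟩
      (x +ₖ β i * a) *ₗ v zero +ᴹ (Lᵢ +ᴹ β i *ₗ L₀)
        ≈⟨ +ᴹ-congʳ (≈ᴹ-trans (*ₗ-distribʳ (v zero) x (β i * a)) (+ᴹ-congˡ (*ₗ-assoc (β i) a (v zero)))) ⟩
      (x *ₗ v zero +ᴹ β i *ₗ (a *ₗ v zero)) +ᴹ (Lᵢ +ᴹ β i *ₗ L₀)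
        ≈⟨ interchange _ _ _ _ ⟩
      (x *ₗ v zero +ᴹ Lᵢ) +ᴹ (β i *ₗ (a *ₗ v zero) +ᴹ β i *ₗ L₀)
        ≈⟨ +ᴹ-congˡ (*ₗ-distribˡ (β i) _ _) ⟨
      (x *ₗ v zero +ᴹ Lᵢ) +ᴹ β i *ₗ (a *ₗ v zero +ᴹ L₀)
        ≈⟨ +ᴹ-cong (lin≈w (punchIn j₀ i)) (*ₗ-congˡ (lin≈w j₀)) ⟩
      w (punchIn j₀ i) +ᴹ β i *ₗ w j₀ ∎
      where
      x  = cf (punchIn j₀ i) zero
      Lᵢ = lin (tail (cf (punchIn j₀ i))) (tail v)
      L₀ = lin (tail (cf j₀)) (tail v)

  steinitz : ∀ p {q} (v : Fin p → Carrierᴹ) (w : Fin q → Carrierᴹ) → LinIndep w →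
             (∀ j → Σ (Fin p → K) λ c → lin c v ≈ᴹ w j) → q ≤ p
  steinitz zero    {zero}  v w ind w∈ = z≤n
  steinitz zero    {suc q} v w ind w∈ =
    ⊥-elim (0≉1 (sym (ind (unit zero) (≈ᴹ-trans (lin-unit zero w) (≈ᴹ-sym (proj₂ (w∈ zero)))) zero)))
  steinitz (suc p) {zero}  v w ind w∈ = z≤n
  steinitz (suc p) {suc q} v w ind w∈ with decide (Σ (Fin (suc q)) λ j → ¬ (proj₁ (w∈ j) zero ≈ 0#))
  ... | no none = m≤n⇒m≤1+n (steinitz p (tail v) w ind drop-head)
    where
    -- no w j uses v 0, so v 0 can be dropped
    drop-head : ∀ j → Σ (Fin p → K) λ c → lin c (tail v) ≈ᴹ w j
    drop-head j = tail (proj₁ (w∈ j)) , ≈ᴹ-trans (≈ᴹ-sym head-vanishes) (proj₂ (w∈ j))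
      where
      head-vanishes : lin (proj₁ (w∈ j)) v ≈ᴹ lin (tail (proj₁ (w∈ j))) (tail v)
      head-vanishes = ≈ᴹ-trans (+ᴹ-congʳ (scale-zero (v zero) (¬¬-elim λ ≉0 → none (j , ≉0)))) (+ᴹ-identityˡ _)
  ... | yes (j₀ , a≉0) with eliminate-head v w (proj₁ ∘ w∈) (proj₂ ∘ w∈) j₀ a≉0
  ...   | β , reduced = s≤s (steinitz p (tail v) _ (shear-indep j₀ β w ind) reduced)

  module _ (X : Subspace) {p : ℕ} (X-dim : HasDim X p) where
    basis : Fin p → Carrierᴹ
    basis = proj₁ X-dim

    basis∈ : ∀ i → X ∋ basis i
    basis∈ = proj₁ (proj₂ X-dim)

    basis-indep : LinIndep basis
    basis-indep = proj₁ (proj₂ (proj₂ X-dim))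

    basis-spans : X ⊆ Span basis
    basis-spans x x∈X = lift (proj₂ (proj₂ (proj₂ X-dim)) x x∈X)

  span-dim : ∀ {p} (w : Fin p → Carrierᴹ) → LinIndep w → HasDim (Span w) p
  span-dim w ind = w , span∋ w , ind , λ x x∈ → lower x∈

  HasDim-resp : ∀ (X Y : Subspace) {p} → X ≐ Y → HasDim X p → HasDim Y p
  HasDim-resp X Y (X⊆Y , Y⊆X) (b , b∈X , ind , spans) =
    b , (λ i → X⊆Y _ (b∈X i)) , ind , (λ y y∈Y → spans y (Y⊆X y y∈Y))

  indep≤dim : ∀ (X : Subspace) {p q} → HasDim X p → (w : Fin q → Carrierᴹ) → (∀ i → X ∋ w i) →
              LinIndep w → q ≤ p
  indep≤dim X {p} X-dim w w∈X ind =
    steinitz p (basis X X-dim) w ind (λ j → lower (basis-spans X X-dim (w j) (w∈X j)))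

  dim-unique : ∀ (X : Subspace) {p q} → HasDim X p → HasDim X q → p ≡ q
  dim-unique X X-p X-q = ≤-antisym (indep≤dim X X-q (basis X X-p) (basis∈ X X-p) (basis-indep X X-p))
                                   (indep≤dim X X-p (basis X X-q) (basis∈ X X-q) (basis-indep X X-q))

  indep-spans : ∀ (X : Subspace) {p} → HasDim X p → (w : Fin p → Carrierᴹ) → (∀ i → X ∋ w i) →
                LinIndep w → X ⊆ Span w
  indep-spans X X-dim w w∈X ind x x∈X = ¬¬-elim λ x∉ →
    <-irrefl P.refl (indep≤dim X X-dim (x ∷ w) (∷-∈ X x∈X w∈X) (indep-∷ ind x∉))

  ⊆-same-dim : ∀ (X Y : Subspace) {p} → X ⊆ Y → HasDim X p → HasDim Y p → Y ⊆ X
  ⊆-same-dim X Y X⊆Y X-dim Y-dim y y∈Y =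
    span⊆ (basis X X-dim) X (basis∈ X X-dim) y
      (indep-spans Y Y-dim (basis X X-dim) (λ i → X⊆Y _ (basis∈ X X-dim i)) (basis-indep X X-dim) y y∈Y)

  outside : ∀ (X S : Subspace) {N p} → HasDim X N → HasDim S p → p < N → Σ Carrierᴹ λ x → X ∋ x × ¬ (S ∋ x)
  outside X S X-dim S-dim p<N = ⊈-witness {X} {S} λ X⊆S →
    <⇒≱ p<N (indep≤dim S S-dim (basis X X-dim) (λ i → X⊆S _ (basis∈ X X-dim i)) (basis-indep X X-dim))

  grow : ∀ (X : Subspace) {N q} → HasDim X N → (w : Fin q → Carrierᴹ) → (∀ i → X ∋ w i) → LinIndep w →
         q < N → Σ Carrierᴹ λ x → X ∋ x × LinIndep (x ∷ w)
  grow X X-dim w w∈X ind q<N with outside X (Span w) X-dim (span-dim w ind) q<N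
  ... | x , x∈X , x∉ = x , x∈X , indep-∷ ind x∉

  extend : ∀ (X : Subspace) {N q} e → HasDim X N → (w : Fin q → Carrierᴹ) → (∀ i → X ∋ w i) →
           LinIndep w → q ≤ e → e ≤ N →
           Σ (Fin e → Carrierᴹ) λ u → (∀ i → X ∋ u i) × LinIndep u × Span w ⊆ Span u
  extend X zero    X-dim w w∈X ind z≤n _ = w , w∈X , ind , λ _ x∈ → x∈
  extend X (suc e) X-dim w w∈X ind q≤1+e e<N with m≤n⇒m<n∨m≡n q≤1+e
  ... | inj₂ P.refl = w , w∈X , ind , λ _ x∈ → x∈
  ... | inj₁ q<1+e with extend X e X-dim w w∈X ind (≤-pred q<1+e) (<⇒≤ e<N)
  ...   | u , u∈X , indu , w⊆u with grow X X-dim u u∈X indu e<N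
  ...     | x , x∈X , indxu = x ∷ u , ∷-∈ X x∈X u∈X , indxu ,
                              λ z z∈ → span⊆ u (Span (x ∷ u)) (span∋ (x ∷ u) ∘ suc) z (w⊆u z z∈)

  indep-family : ∀ (X : Subspace) {N} q → HasDim X N → q ≤ N →
                 Σ (Fin q → Carrierᴹ) λ u → (∀ i → X ∋ u i) × LinIndep u
  indep-family X q X-dim q≤N with extend X q X-dim (λ ()) (λ ()) (λ _ _ ()) z≤n q≤N
  ... | u , u∈X , indu , _ = u , u∈X , indu

  -- Every subspace Y of a finite-dimensional X has a dimension: an
  -- independent family in Y that cannot be grown spans Y, and growing stops
  -- after at most dim X steps.
  dim-exists : ∀ (X Y : Subspace) {N} → HasDim X N → Y ⊆ X → Σ ℕ (HasDim Y)
  dim-exists X Y {N} X-dim Y⊆X = search N (λ ()) (λ ()) (λ _ _ ()) (ℕP.+-identityʳ N)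
    where
    search : ∀ t {q} (w : Fin q → Carrierᴹ) → (∀ i → Y ∋ w i) → LinIndep w → t + q ≡ N → Σ ℕ (HasDim Y)
    search t {q} w w∈Y ind t+q≡N
      with decide (Σ (Fin (suc q) → Carrierᴹ) λ u → (∀ i → Y ∋ u i) × LinIndep u)
    search zero    w w∈Y ind q≡N | yes (u , u∈Y , indu) =
      ⊥-elim (<-irrefl q≡N (indep≤dim X X-dim u (λ i → Y⊆X _ (u∈Y i)) indu))
    search (suc t) w w∈Y ind t+q≡N | yes (u , u∈Y , indu) =
      search t u u∈Y indu (P.trans (ℕP.+-suc t _) t+q≡N)
    search t {q} w w∈Y ind t+q≡N | no cannot-grow = q , w , w∈Y , ind , λ y y∈Y →
      lower (¬¬-elim λ y∉ → cannot-grow (y ∷ w , ∷-∈ Y y∈Y w∈Y , indep-∷ ind y∉))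

  indep-∷-basis : ∀ (X : Subspace) {p} (X-dim : HasDim X p) {x} → ¬ (X ∋ x) → LinIndep (x ∷ basis X X-dim)
  indep-∷-basis X X-dim {x} x∉X =
    indep-∷ {w = basis X X-dim} (basis-indep X X-dim) (x∉X ∘ span⊆ (basis X X-dim) X (basis∈ X X-dim) x)

  covering-subspace : ∀ (X : Subspace) {N t} e → HasDim X N → (g : Fin t → Carrierᴹ) →
                      (∀ i → X ∋ g i) → t ≤ e → e ≤ N → Σ (𝒢 e) λ U → Span g ⊆ proj₁ U
  covering-subspace X {t = t} e X-dim g g∈X t≤e e≤N with dim-exists X (Span g) X-dim (span⊆ g X g∈X)
  ... | q , G-dim with extend X e X-dim b (λ i → span⊆ g X g∈X _ (basis∈ G G-dim i)) (basis-indep G G-dim) q≤e e≤N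
    where
    G = Span g
    b = basis G G-dim
    q≤e = ≤-trans (steinitz t g b (basis-indep G G-dim) (lower ∘ basis∈ G G-dim)) t≤e
  ...   | u , _ , indu , G⊆u = (Span u , span-dim u indu) , λ z z∈ → G⊆u z (basis-spans (Span g) G-dim z z∈)

module GrassmannGeometry {c ℓ m ℓm : Level} (em : ∀ {a} → ExcludedMiddle a)
         (DR : DivisionRing c ℓ) (V : LeftModule (DivisionRing.ring DR) m ℓm) where
  open Ring (DivisionRing.ring DR) using () renaming (Carrier to K; _+_ to _+ₖ_)
  open LeftModule V
  open CommutativeSemigroupProperties
         (CommutativeMonoid.commutativeSemigroup +ᴹ-commutativeMonoid)
         using (interchange; x∙yz≈y∙xz)
  open LinAlg DR V public
  open LinearAlgebra em DR V public
  open import Relation.Binary.Reasoning.Setoid ≈ᴹ-setoid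

  ∩⊆ˡ : (X Y : Subspace) → (X ∩ Y) ⊆ X
  ∩⊆ˡ X Y x = proj₁

  adj-distinct : ∀ {k₀} (X Y : 𝒢 (suc k₀)) → Adj (suc k₀) X Y → ¬ (proj₁ X ≐ proj₁ Y)
  adj-distinct (X , X-dim) (Y , Y-dim) X∩Y-dim (X⊆Y , _) =
    1+n≢n (P.sym (dim-unique (X ∩ Y) X∩Y-dim (HasDim-resp X (X ∩ Y) X≐X∩Y X-dim)))
    where
    X≐X∩Y : X ≐ (X ∩ Y)
    X≐X∩Y = (λ x x∈X → x∈X , X⊆Y x x∈X) , ∩⊆ˡ X Y

  -- Distinct k-spaces through a common (k-1)-space S are adjacent: a vector
  -- of X ∩ Y outside S together with S would span both X and Y.
  star-adj : ∀ {k₀} (S : 𝒢 k₀) (X Y : 𝒢 (suc k₀)) → proj₁ S ⊆ proj₁ X → proj₁ S ⊆ proj₁ Y →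
             ¬ (proj₁ X ≐ proj₁ Y) → Adj (suc k₀) X Y
  star-adj (S , S-dim) (X , X-dim) (Y , Y-dim) S⊆X S⊆Y X≠Y =
    HasDim-resp S (X ∩ Y) ((λ s s∈S → S⊆X s s∈S , S⊆Y s s∈S) , X∩Y⊆S) S-dim
    where
    bS = basis S S-dim
    X∩Y⊆S : (X ∩ Y) ⊆ S
    X∩Y⊆S z (z∈X , z∈Y) = ¬¬-elim λ z∉S → X≠Y (X⊆Y z∉S , ⊆-same-dim X Y (X⊆Y z∉S) X-dim Y-dim)
      where
      X⊆Y : ¬ (S ∋ z) → X ⊆ Y
      X⊆Y z∉S x x∈X =
        span⊆ (z ∷ bS) Y (∷-∈ Y z∈Y (λ i → S⊆Y _ (basis∈ S S-dim i))) x
          (indep-spans X X-dim (z ∷ bS) (∷-∈ X z∈X (λ i → S⊆X _ (basis∈ S S-dim i)))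
             (indep-∷-basis S S-dim z∉S) x x∈X)

  -- Distinct k-spaces X, Y of a (k+1)-space U are adjacent: for y ∈ Y ∖ X,
  -- y and X span U, so y and X ∩ Y span Y, which pins down dim (X ∩ Y).
  top-adj : ∀ {k₀} (U : Subspace) → HasDim U (suc (suc k₀)) → (X Y : 𝒢 (suc k₀)) →
            proj₁ X ⊆ U → proj₁ Y ⊆ U → ¬ (proj₁ X ≐ proj₁ Y) → Adj (suc k₀) X Y
  top-adj {k₀} U U-dim (X , X-dim) (Y , Y-dim) X⊆U Y⊆U X≠Y
    with ⊈-witness {Y} {X} Y⊈X | dim-exists X (X ∩ Y) X-dim (∩⊆ˡ X Y)
    where
    Y⊈X : ¬ (Y ⊆ X)
    Y⊈X Y⊆X = X≠Y (⊆-same-dim Y X Y⊆X Y-dim X-dim , Y⊆X)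
  ... | y , y∈Y , y∉X | q , I-dim = P.subst (HasDim (X ∩ Y)) q≡k₀ I-dim
    where
    bX = basis X X-dim
    bI = basis (X ∩ Y) I-dim
    U⊆y+X : U ⊆ Span (y ∷ bX)
    U⊆y+X = indep-spans U U-dim (y ∷ bX) (∷-∈ U (Y⊆U y y∈Y) (X⊆U _ ∘ basis∈ X X-dim))
              (indep-∷-basis X X-dim y∉X)
    rest∈X∩Y : ∀ {z} → Y ∋ z → (r : Fin (suc (suc k₀)) → K) → lin r (y ∷ bX) ≈ᴹ z → (X ∩ Y) ∋ lin (tail r) bX
    rest∈X∩Y z∈Y r e = lin∈ X (tail r) bX (basis∈ X X-dim) ,
      ∋-cancel Y (resp Y (≈ᴹ-trans (≈ᴹ-sym e) (+ᴹ-comm _ _)) z∈Y) (∋* Y (r zero) y∈Y)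
    Y⊆y+I : Y ⊆ Span (y ∷ bI)
    Y⊆y+I z z∈Y with U⊆y+X z (Y⊆U z z∈Y)
    ... | lift (r , e) with basis-spans (X ∩ Y) I-dim _ (rest∈X∩Y z∈Y r e)
    ...   | lift (c , e′) = lift (r zero ∷ c , ≈ᴹ-trans (+ᴹ-congˡ e′) e)
    k≤1+q : suc k₀ ≤ suc q
    k≤1+q = steinitz (suc q) (y ∷ bI) (basis Y Y-dim) (basis-indep Y Y-dim) (lower ∘ Y⊆y+I _ ∘ basis∈ Y Y-dim)
    q≤k : q ≤ suc k₀
    q≤k = indep≤dim X X-dim bI (proj₁ ∘ basis∈ (X ∩ Y) I-dim) (basis-indep (X ∩ Y) I-dim)
    q≢k : q ≢ suc k₀
    q≢k q≡k = X≠Y (X⊆Y , ⊆-same-dim X Y X⊆Y X-dim Y-dim)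
      where
      X⊆Y : X ⊆ Y
      X⊆Y x x∈X = proj₂ (⊆-same-dim (X ∩ Y) X (∩⊆ˡ X Y) (P.subst (HasDim (X ∩ Y)) q≡k I-dim) X-dim x x∈X)
    q≡k₀ : q ≡ k₀
    q≡k₀ = ≤-antisym (≤-pred (≤∧≢⇒< q≤k q≢k)) (≤-pred k≤1+q)

  _⊕_ : Subspace → Subspace → Subspace
  X ⊕ Y = record
    { _∋_  = λ z → Σ Carrierᴹ λ x → Σ Carrierᴹ λ y → (X ∋ x) × (Y ∋ y) × (x +ᴹ y ≈ᴹ z)
    ; resp = λ { e (x , y , x∈ , y∈ , e′) → x , y , x∈ , y∈ , ≈ᴹ-trans e′ e }
    ; ∋0   = 0ᴹ , 0ᴹ , ∋0 X , ∋0 Y , +ᴹ-identityˡ 0ᴹ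
    ; ∋+   = λ { (x , y , x∈ , y∈ , e) (x′ , y′ , x′∈ , y′∈ , e′) →
                 x +ᴹ x′ , y +ᴹ y′ , ∋+ X x∈ x′∈ , ∋+ Y y∈ y′∈ ,
                 ≈ᴹ-trans (interchange x x′ y y′) (+ᴹ-cong e e′) }
    ; ∋*   = λ { a (x , y , x∈ , y∈ , e) → a *ₗ x , a *ₗ y , ∋* X a x∈ , ∋* Y a y∈ ,
                 ≈ᴹ-trans (≈ᴹ-sym (*ₗ-distribˡ a x y)) (*ₗ-congˡ e) } }

  ⊕ˡ : (X Y : Subspace) → X ⊆ (X ⊕ Y)
  ⊕ˡ X Y x x∈X = x , 0ᴹ , x∈X , ∋0 Y , +ᴹ-identityʳ x

  ⊕ʳ : (X Y : Subspace) → Y ⊆ (X ⊕ Y)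
  ⊕ʳ X Y y y∈Y = 0ᴹ , y , ∋0 X , y∈Y , +ᴹ-identityˡ y

  ⊕-least : (X Y Z : Subspace) → X ⊆ Z → Y ⊆ Z → (X ⊕ Y) ⊆ Z
  ⊕-least X Y Z X⊆Z Y⊆Z z (x , y , x∈X , y∈Y , e) = resp Z e (∋+ Z (X⊆Z x x∈X) (Y⊆Z y y∈Y))

  -- The sum of adjacent k-spaces A, B is a (k+1)-space: for a ∈ A ∖ B and
  -- b ∈ B ∖ A, the vectors b, a and a basis of A ∩ B form a basis of A ⊕ B.
  sum-dim : ∀ {k₀} (A B : 𝒢 (suc k₀)) → Adj (suc k₀) A B → HasDim (proj₁ A ⊕ proj₁ B) (suc (suc k₀))
  sum-dim {k₀} (A , A-dim) (B , B-dim) S-dim with ⊈-witness {A} {B} A⊈B | ⊈-witness {B} {A} B⊈A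
    where
    A≠B = adj-distinct (A , A-dim) (B , B-dim) S-dim
    A⊈B : ¬ (A ⊆ B)
    A⊈B A⊆B = A≠B (A⊆B , ⊆-same-dim A B A⊆B A-dim B-dim)
    B⊈A : ¬ (B ⊆ A)
    B⊈A B⊆A = A≠B (⊆-same-dim B A B⊆A B-dim A-dim , B⊆A)
  ... | a , a∈A , a∉B | b , b∈B , b∉A =
    b ∷ a ∷ bS , ∷-∈ (A ⊕ B) (⊕ʳ A B b b∈B) (⊕ˡ A B _ ∘ a∷S∈A) , ind , spans
    where
    S = A ∩ B
    bS = basis S S-dim
    bS∈S = basis∈ S S-dim
    a∷S∈A = ∷-∈ A a∈A (proj₁ ∘ bS∈S)
    b∷S∈B = ∷-∈ B b∈B (proj₂ ∘ bS∈S)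
    a+S-indep : LinIndep (a ∷ bS)
    a+S-indep = indep-∷-basis S S-dim (a∉B ∘ proj₂)
    A⊆a+S : A ⊆ Span (a ∷ bS)
    A⊆a+S = indep-spans A A-dim (a ∷ bS) a∷S∈A a+S-indep
    B⊆b+S : B ⊆ Span (b ∷ bS)
    B⊆b+S = indep-spans B B-dim (b ∷ bS) b∷S∈B (indep-∷-basis S S-dim (b∉A ∘ proj₁))
    ind : LinIndep (b ∷ a ∷ bS)
    ind = indep-∷ {w = a ∷ bS} a+S-indep (b∉A ∘ span⊆ (a ∷ bS) A a∷S∈A b)
    spans : ∀ z → (A ⊕ B) ∋ z → Σ (Fin (suc (suc k₀)) → K) λ t → lin t (b ∷ a ∷ bS) ≈ᴹ z
    spans z (x , y , x∈A , y∈B , x+y≈z) with A⊆a+S x x∈A | B⊆b+S y y∈B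
    ... | lift (r , r≈x) | lift (s , s≈y) = s zero ∷ r zero ∷ (λ i → r (suc i) +ₖ s (suc i)) , (begin
      s zero *ₗ b +ᴹ (r zero *ₗ a +ᴹ lin (λ i → r (suc i) +ₖ s (suc i)) bS)
        ≈⟨ +ᴹ-congˡ (+ᴹ-congˡ (lin-+ (tail r) (tail s) bS)) ⟩
      s zero *ₗ b +ᴹ (r zero *ₗ a +ᴹ (lin (tail r) bS +ᴹ lin (tail s) bS))
        ≈⟨ +ᴹ-congˡ (+ᴹ-assoc _ _ _) ⟨
      s zero *ₗ b +ᴹ ((r zero *ₗ a +ᴹ lin (tail r) bS) +ᴹ lin (tail s) bS)
        ≈⟨ x∙yz≈y∙xz _ _ _ ⟩
      (r zero *ₗ a +ᴹ lin (tail r) bS) +ᴹ (s zero *ₗ b +ᴹ lin (tail s) bS)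
        ≈⟨ +ᴹ-cong r≈x s≈y ⟩
      x +ᴹ y
        ≈⟨ x+y≈z ⟩
      z ∎)

  star-of-adjacent : ∀ {k₀} (A B : 𝒢 (suc k₀)) → Adj (suc k₀) A B → (S : 𝒢 k₀) →
                     proj₁ S ⊆ proj₁ A → proj₁ S ⊆ proj₁ B → (proj₁ A ∩ proj₁ B) ⊆ proj₁ S
  star-of-adjacent (A , _) (B , _) adj (S , S-dim) S⊆A S⊆B =
    ⊆-same-dim S (A ∩ B) (λ x x∈S → S⊆A x x∈S , S⊆B x x∈S) S-dim adj

  top-of-adjacent : ∀ {k₀} (A B : 𝒢 (suc k₀)) → Adj (suc k₀) A B → (U : Subspace) →
                    HasDim U (suc (suc k₀)) → proj₁ A ⊆ U → proj₁ B ⊆ U → U ⊆ (proj₁ A ⊕ proj₁ B)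
  top-of-adjacent A B adj U U-dim A⊆U B⊆U =
    ⊆-same-dim (proj₁ A ⊕ proj₁ B) U (⊕-least (proj₁ A) (proj₁ B) U A⊆U B⊆U) (sum-dim A B adj) U-dim

  Near : ∀ p → 𝒢 p → 𝒢 p → Set ℓs
  Near p X Y = Adj p X Y ⊎ (proj₁ X ≐ proj₁ Y)

  near-by-cases : ∀ {p} (X Y : 𝒢 p) → (¬ (proj₁ X ≐ proj₁ Y) → Adj p X Y) → Near p X Y
  near-by-cases X Y adj with decide (proj₁ X ≐ proj₁ Y)
  ... | yes X≐Y = inj₂ X≐Y
  ... | no X≠Y = inj₁ (adj X≠Y)

  near-distinct⇒adj : ∀ {p} (X Y : 𝒢 p) → Near p X Y → ¬ (proj₁ X ≐ proj₁ Y) → Adj p X Y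
  near-distinct⇒adj X Y (inj₁ adj) X≠Y = adj
  near-distinct⇒adj X Y (inj₂ X≐Y) X≠Y = ⊥-elim (X≠Y X≐Y)

  -- A vertex Z near both of the adjacent A, B and not through A ∩ B lies in
  -- A ⊕ B: Z is spanned by Z ∩ B and a vector of (Z ∩ A) ∖ (Z ∩ B).
  near-both⇒⊆sum : ∀ {k₀} (A B Z : 𝒢 (suc k₀)) → Adj (suc k₀) A B → Near _ Z A → Near _ Z B →
                   ¬ ((proj₁ A ∩ proj₁ B) ⊆ proj₁ Z) → proj₁ Z ⊆ (proj₁ A ⊕ proj₁ B)
  near-both⇒⊆sum (A , _) (B , _) (Z , _) _ (inj₂ (Z⊆A , _)) _ _ = λ z z∈ → ⊕ˡ A B z (Z⊆A z z∈)
  near-both⇒⊆sum (A , _) (B , _) (Z , _) _ (inj₁ _) (inj₂ (Z⊆B , _)) _ = λ z z∈ → ⊕ʳ A B z (Z⊆B z z∈)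
  near-both⇒⊆sum (A , _) (B , _) (Z , Z-dim) S-dim (inj₁ ZA-dim) (inj₁ ZB-dim) S⊈Z
    with ⊈-witness {Z ∩ A} {Z ∩ B} ZA⊈ZB
    where
    ZA⊈ZB : ¬ ((Z ∩ A) ⊆ (Z ∩ B))
    ZA⊈ZB ZA⊆ZB = S⊈Z λ x x∈S → proj₁ (⊆-same-dim (Z ∩ A) (A ∩ B) ZA⊆S ZA-dim S-dim x x∈S)
      where
      ZA⊆S : (Z ∩ A) ⊆ (A ∩ B)
      ZA⊆S x x∈ZA = proj₂ x∈ZA , proj₂ (ZA⊆ZB x x∈ZA)
  ... | h , (h∈Z , h∈A) , h∉ZB = λ z z∈Z → Z⊆sum z (Z⊆h+ZB z z∈Z)
    where
    bZB = basis (Z ∩ B) ZB-dim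
    Z⊆h+ZB : Z ⊆ Span (h ∷ bZB)
    Z⊆h+ZB = indep-spans Z Z-dim (h ∷ bZB) (∷-∈ Z h∈Z (proj₁ ∘ basis∈ (Z ∩ B) ZB-dim))
               (indep-∷-basis (Z ∩ B) ZB-dim h∉ZB)
    Z⊆sum : Span (h ∷ bZB) ⊆ (A ⊕ B)
    Z⊆sum = span⊆ (h ∷ bZB) (A ⊕ B) (∷-∈ (A ⊕ B) (⊕ˡ A B h h∈A) (⊕ʳ A B _ ∘ proj₂ ∘ basis∈ (Z ∩ B) ZB-dim))

  -- Two near vertices cannot split as: Z₁ inside A ⊕ B but not through A ∩ B,
  -- and Z₂ through A ∩ B but not inside A ⊕ B.  Otherwise Z₁ ∩ Z₂ lies in
  -- A ∩ B (Z₂ is spanned by A ∩ B and a vector outside A ⊕ B), and so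
  -- equals it, forcing A ∩ B ⊆ Z₁.
  near-no-split : ∀ {k₀} (A B Z₁ Z₂ : 𝒢 (suc k₀)) → Adj (suc k₀) A B → Near _ Z₁ Z₂ →
                  proj₁ Z₁ ⊆ (proj₁ A ⊕ proj₁ B) → ¬ ((proj₁ A ∩ proj₁ B) ⊆ proj₁ Z₁) →
                  (proj₁ A ∩ proj₁ B) ⊆ proj₁ Z₂ → ¬ (proj₁ Z₂ ⊆ (proj₁ A ⊕ proj₁ B)) → ⊥
  near-no-split _ _ _ _ _ (inj₂ (_ , Z₂⊆Z₁)) _ S⊈Z₁ S⊆Z₂ _ = S⊈Z₁ λ x x∈S → Z₂⊆Z₁ x (S⊆Z₂ x x∈S)
  near-no-split (A , _) (B , _) (Z₁ , _) (Z₂ , Z₂-dim) S-dim (inj₁ I-dim) Z₁⊆A+B S⊈Z₁ S⊆Z₂ Z₂⊈A+B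
    with ⊈-witness {Z₂} {A ⊕ B} Z₂⊈A+B
  ... | y , y∈Z₂ , y∉A+B = S⊈Z₁ λ x x∈S → proj₁ (⊆-same-dim (Z₁ ∩ Z₂) S I⊆S I-dim S-dim x x∈S)
    where
    S = A ∩ B
    bS = basis S S-dim
    S⊆A+B : S ⊆ (A ⊕ B)
    S⊆A+B x x∈S = ⊕ˡ A B x (proj₁ x∈S)
    Z₂⊆y+S : Z₂ ⊆ Span (y ∷ bS)
    Z₂⊆y+S = indep-spans Z₂ Z₂-dim (y ∷ bS) (∷-∈ Z₂ y∈Z₂ (S⊆Z₂ _ ∘ basis∈ S S-dim))
               (indep-∷-basis S S-dim (y∉A+B ∘ S⊆A+B y))
    I⊆S : (Z₁ ∩ Z₂) ⊆ S
    I⊆S z (z∈Z₁ , z∈Z₂) =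
      cone-meet S (A ⊕ B) bS (basis∈ S S-dim) S⊆A+B y∉A+B (Z₂⊆y+S z z∈Z₂) (Z₁⊆A+B z z∈Z₁)

  clique-star-or-top : ∀ {k₀ ι} {I : Set ι} (g : I → 𝒢 (suc k₀)) → (∀ i j → Near _ (g i) (g j)) →
                       (i₁ i₂ : I) → Adj _ (g i₁) (g i₂) →
                       (∀ i → (proj₁ (g i₁) ∩ proj₁ (g i₂)) ⊆ proj₁ (g i)) ⊎
                       (∀ i → proj₁ (g i) ⊆ (proj₁ (g i₁) ⊕ proj₁ (g i₂)))
  clique-star-or-top {I = I} g near i₁ i₂ adj with decide (∀ i → (proj₁ (g i₁) ∩ proj₁ (g i₂)) ⊆ proj₁ (g i))
  ... | yes in-star = inj₁ in-star
  ... | no not-in-star = inj₂ λ i → ¬¬-elim λ gi⊈A+B →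
          near-no-split (g i₁) (g i₂) (g i₀) (g i) adj (near i₀ i) (in-sum i₀ Ai₀) Ai₀
                        (¬¬-elim λ S⊈gi → gi⊈A+B (in-sum i S⊈gi)) gi⊈A+B
    where
    in-sum : ∀ i → ¬ ((proj₁ (g i₁) ∩ proj₁ (g i₂)) ⊆ proj₁ (g i)) →
             proj₁ (g i) ⊆ (proj₁ (g i₁) ⊕ proj₁ (g i₂))
    in-sum i = near-both⇒⊆sum (g i₁) (g i₂) (g i) adj (near i i₁) (near i i₂)
    witness : Σ I λ i → ¬ ((proj₁ (g i₁) ∩ proj₁ (g i₂)) ⊆ proj₁ (g i))
    witness = ¬¬-elim λ none → not-in-star λ i → ¬¬-elim λ S⊈gi → none (i , S⊈gi)
    i₀ = proj₁ witness
    Ai₀ = proj₂ witness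

  star-near : ∀ {k₀} (S : 𝒢 k₀) (X Y : 𝒢 (suc k₀)) → proj₁ S ⊆ proj₁ X → proj₁ S ⊆ proj₁ Y → Near _ X Y
  star-near S X Y S⊆X S⊆Y = near-by-cases X Y (star-adj S X Y S⊆X S⊆Y)

  top-near : ∀ {k₀} (U : Subspace) → HasDim U (suc (suc k₀)) → (X Y : 𝒢 (suc k₀)) →
             proj₁ X ⊆ U → proj₁ Y ⊆ U → Near _ X Y
  top-near U U-dim X Y X⊆U Y⊆U = near-by-cases X Y (top-adj U U-dim X Y X⊆U Y⊆U)

  -- For S ⊆ U, v ∉ U and a k-space Z ⊆ U not through S, the k-space
  -- Y = S + ⟨v⟩ passes through S and is neither equal nor adjacent to Z:
  -- Y ∩ Z lies in S (cone-meet), so it cannot have dimension k-1.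
  cone-far : ∀ {k₀} (S : 𝒢 k₀) (U : Subspace) (Z : 𝒢 (suc k₀)) → proj₁ S ⊆ U → proj₁ Z ⊆ U →
             ¬ (proj₁ S ⊆ proj₁ Z) → ∀ {v} → ¬ (U ∋ v) →
             Σ (𝒢 (suc k₀)) λ Y → proj₁ S ⊆ proj₁ Y × ¬ (proj₁ Y ≐ proj₁ Z) × ¬ Adj (suc k₀) Y Z
  cone-far (S , S-dim) U (Z , Z-dim) S⊆U Z⊆U S⊈Z {v} v∉U = (Y , Y-dim) , S⊆Y , Y≠Z , Y-Z-far
    where
    bS = basis S S-dim
    Y = Span (v ∷ bS)
    Y-dim = span-dim (v ∷ bS) (indep-∷-basis S S-dim (v∉U ∘ S⊆U v))
    S⊆Y : S ⊆ Y
    S⊆Y x x∈S = span⊆ bS Y (span∋ (v ∷ bS) ∘ suc) x (basis-spans S S-dim x x∈S)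
    Y≠Z : ¬ (Y ≐ Z)
    Y≠Z (Y⊆Z , _) = v∉U (Z⊆U v (Y⊆Z v (span∋ (v ∷ bS) zero)))
    Y-Z-far : ¬ Adj _ (Y , Y-dim) (Z , Z-dim)
    Y-Z-far I-dim = S⊈Z λ x x∈S → proj₂ (⊆-same-dim (Y ∩ Z) S I⊆S I-dim S-dim x x∈S)
      where
      I⊆S : (Y ∩ Z) ⊆ S
      I⊆S z (z∈Y , z∈Z) = cone-meet S U bS (basis∈ S S-dim) S⊆U v∉U z∈Y (Z⊆U z z∈Z)

  face : ∀ {p} (u : Fin (suc p) → Carrierᴹ) → LinIndep u → Fin (suc p) → 𝒢 p
  face u ind j = Span (u ∘ punchIn j) , span-dim (u ∘ punchIn j) (indep-remove j {u} ind)

  record Pencil {a} (S : 𝒢 (suc a)) (W : Subspace) : Set (lsuc ℓs) where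
    field
      X₀ X₁ X₂ : 𝒢 (suc (suc a))
      X₀⊆W     : proj₁ X₀ ⊆ W
      X₁⊆W     : proj₁ X₁ ⊆ W
      X₂⊆W     : proj₁ X₂ ⊆ W
      S⊆X₀     : proj₁ S ⊆ proj₁ X₀
      S⊆X₁     : proj₁ S ⊆ proj₁ X₁
      X₀≠X₁    : ¬ (proj₁ X₀ ≐ proj₁ X₁)
      S⊈X₂     : ¬ (proj₁ S ⊆ proj₁ X₂)

  faces-pencil : ∀ {a} (S : 𝒢 (suc a)) (W : Subspace) (u₀ u₁ : Carrierᴹ) →
                 let u = u₀ ∷ u₁ ∷ basis (proj₁ S) (proj₂ S) in
                 LinIndep u → (∀ i → W ∋ u i) → Pencil S W
  faces-pencil (S , S-dim) W u₀ u₁ ind u∈W = record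
    { X₀ = face u ind zero ; X₁ = face u ind (suc zero) ; X₂ = face u ind (suc (suc zero))
    ; X₀⊆W = face⊆W zero ; X₁⊆W = face⊆W (suc zero) ; X₂⊆W = face⊆W (suc (suc zero))
    ; S⊆X₀ = S⊆span (u ∘ punchIn zero) (span∋ (u ∘ punchIn zero) ∘ suc)
    ; S⊆X₁ = S⊆span (u ∘ punchIn (suc zero)) (span∋ (u ∘ punchIn (suc zero)) ∘ suc)
    ; X₀≠X₁ = λ (_ , X₁⊆X₀) → indep-∉ zero {u} ind (X₁⊆X₀ u₀ (span∋ (u ∘ punchIn (suc zero)) zero))
    ; S⊈X₂ = λ S⊆X₂ → indep-∉ (suc (suc zero)) {u} ind (S⊆X₂ _ (basis∈ S S-dim zero)) }
    where
    u = u₀ ∷ u₁ ∷ basis S S-dim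
    face⊆W : ∀ j → Span (u ∘ punchIn j) ⊆ W
    face⊆W j = span⊆ (u ∘ punchIn j) W (u∈W ∘ punchIn j)
    -- faces 0 and 1 keep the basis of S (positions 2, 3, …), so contain S
    S⊆span : ∀ {q} (w : Fin q → Carrierᴹ) → (∀ i → Span w ∋ basis S S-dim i) → S ⊆ Span w
    S⊆span w bS∈ x x∈S = span⊆ (basis S S-dim) (Span w) bS∈ x (basis-spans S S-dim x x∈S)

  -- A pencil exists: extend a basis of S by two vectors u₁, u₀ of W.
  pencil : ∀ {a N} (S : 𝒢 (suc a)) (W : Subspace) → HasDim W N → suc (suc (suc a)) ≤ N → proj₁ S ⊆ W → Pencil S W
  pencil (S , S-dim) W W-dim a+3≤N S⊆W =
    add-second (grow W W-dim bS bS∈W (basis-indep S S-dim) (≤-trans (n≤1+n _) a+3≤N))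
    where
    bS = basis S S-dim
    bS∈W = S⊆W _ ∘ basis∈ S S-dim
    add-second : (Σ Carrierᴹ λ u₁ → W ∋ u₁ × LinIndep (u₁ ∷ bS)) → Pencil (S , S-dim) W
    add-second (u₁ , u₁∈W , ind₁) with grow W W-dim (u₁ ∷ bS) (∷-∈ W u₁∈W bS∈W) ind₁ a+3≤N
    ... | u₀ , u₀∈W , ind₀ = faces-pencil (S , S-dim) W u₀ u₁ ind₀ (∷-∈ W u₀∈W (∷-∈ W u₁∈W bS∈W))

-- An embedding f of Γ_k(V) in Γ_k'(V'), with k = a + 2, k' = b + 2 and
-- k + 2 ≤ n = dim V.
module Embedding {c ℓ m ℓm c′ ℓ′ m′ ℓm′ : Level} (em : ∀ {a} → ExcludedMiddle a)
  (R : DivisionRing c ℓ) (V : LeftModule (DivisionRing.ring R) m ℓm)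
  (R′ : DivisionRing c′ ℓ′) (V′ : LeftModule (DivisionRing.ring R′) m′ ℓm′)
  (n a b : ℕ) (V-dim : LinAlg.DimIs R V n) (k+2≤n : suc (suc (suc (suc a))) ≤ n)
  (f : LinAlg.𝒢 R V (suc (suc a)) → LinAlg.𝒢 R′ V′ (suc (suc b)))
  (emb : IsEmbedding R V R′ V′ (suc (suc a)) (suc (suc b)) f) where

  module A = GrassmannGeometry em R V
  module B = GrassmannGeometry em R′ V′
  open IsEmbedding emb
  open LeftModule V using (Carrierᴹ; ≈ᴹ-reflexive)

  k k′ : ℕ
  k  = suc (suc a)
  k′ = suc (suc b)

  k+1≡1+k : k + 1 ≡ suc k
  k+1≡1+k = ℕP.+-comm k 1

  k+1<n : k + 1 < n
  k+1<n = P.subst (λ t → suc t ≤ n) (P.sym k+1≡1+k) k+2≤n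

  StarToStar StarToTop : A.𝒢 (suc a) → Set (lsuc (A.ℓs ⊔ B.ℓs))
  StarToStar S = Σ (B.𝒢 (suc b)) λ S′ → ∀ X → proj₁ S A.⊆ proj₁ X → proj₁ S′ B.⊆ proj₁ (f X)
  StarToTop  S = Σ (B.𝒢 (k′ + 1)) λ U′ → ∀ X → proj₁ S A.⊆ proj₁ X → proj₁ (f X) B.⊆ proj₁ U′

  TopToStar TopToTop : A.𝒢 (k + 1) → Set (lsuc (A.ℓs ⊔ B.ℓs))
  TopToStar U = Σ (B.𝒢 (suc b)) λ S′ → ∀ X → proj₁ X A.⊆ proj₁ U → proj₁ S′ B.⊆ proj₁ (f X)
  TopToTop  U = Σ (B.𝒢 (k′ + 1)) λ U′ → ∀ X → proj₁ X A.⊆ proj₁ U → proj₁ (f X) B.⊆ proj₁ U′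

  near-image : (X Y : A.𝒢 k) → A.Near k X Y → B.Near k′ (f X) (f Y)
  near-image X Y (inj₁ adj) = inj₁ (adj→adj X Y adj)
  near-image X Y (inj₂ X≐Y) = inj₂ (well-defined X Y X≐Y)

  clique-image : ∀ {ι} {I : Set ι} (g : I → A.𝒢 k) → (∀ i j → A.Near k (g i) (g j)) →
                 (i₁ i₂ : I) → ¬ (proj₁ (g i₁) A.≐ proj₁ (g i₂)) →
                 (Σ (B.𝒢 (suc b)) λ S′ → ∀ i → proj₁ S′ B.⊆ proj₁ (f (g i))) ⊎
                 (Σ (B.𝒢 (k′ + 1)) λ U′ → ∀ i → proj₁ (f (g i)) B.⊆ proj₁ U′)
  clique-image g near i₁ i₂ g₁≠g₂ =
    Sum.map (meet ,_) (sum ,_) (B.clique-star-or-top (f ∘ g) (λ i j → near-image (g i) (g j) (near i j)) i₁ i₂ f-adj)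
    where
    f-adj : B.Adj k′ (f (g i₁)) (f (g i₂))
    f-adj = adj→adj (g i₁) (g i₂) (A.near-distinct⇒adj (g i₁) (g i₂) (near i₁ i₂) g₁≠g₂)
    meet : B.𝒢 (suc b)
    meet = proj₁ (f (g i₁)) B.∩ proj₁ (f (g i₂)) , f-adj
    sum : B.𝒢 (k′ + 1)
    sum = F , P.subst (B.HasDim F) (P.sym (ℕP.+-comm k′ 1)) (B.sum-dim (f (g i₁)) (f (g i₂)) f-adj)
      where F = proj₁ (f (g i₁)) B.⊕ proj₁ (f (g i₂))

  star-in-top : (U : A.𝒢 (k + 1)) → Σ (A.𝒢 (suc a)) λ S → proj₁ S A.⊆ proj₁ U
  star-in-top (U , U-dim) with A.indep-family U (suc a) U-dim (≤-trans (n≤1+n (suc a)) (m≤m+n k 1))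
  ... | u , u∈U , indu = (A.Span u , A.span-dim u indu) , A.span⊆ u U u∈U

  -- Stars and tops are cliques, so their images lie in a star or a top.

  star-image : (S : A.𝒢 (suc a)) → StarToStar S ⊎ StarToTop S
  star-image S = Sum.map (map₂ curry) (map₂ curry)
    (clique-image {I = Σ (A.𝒢 k) λ X → proj₁ S A.⊆ proj₁ X} proj₁
                  (λ (X , S⊆X) (Y , S⊆Y) → A.star-near S X Y S⊆X S⊆Y) (X₀ , S⊆X₀) (X₁ , S⊆X₁) X₀≠X₁)
    where open A.Pencil (A.pencil S A.whole V-dim (≤-trans (n≤1+n _) k+2≤n) (λ _ _ → _))

  top-image : (U : A.𝒢 (k + 1)) → TopToStar U ⊎ TopToTop U
  top-image (U , U-dim) = Sum.map (map₂ curry) (map₂ curry)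
    (clique-image {I = Σ (A.𝒢 k) λ X → proj₁ X A.⊆ U} proj₁
                  (λ (X , X⊆U) (Y , Y⊆U) → A.top-near U (P.subst (A.HasDim U) k+1≡1+k U-dim) X Y X⊆U Y⊆U)
                  (X₀ , X₀⊆W) (X₁ , X₁⊆W) X₀≠X₁)
    where
    S = star-in-top (U , U-dim)
    open A.Pencil (A.pencil (proj₁ S) U U-dim (≤-reflexive (P.sym k+1≡1+k)) (proj₂ S))

  -- Take the pencil X₀, X₁, X₂ of S in U, a vector v ∉ U and Y = S + ⟨v⟩:
  -- then Y and X₂ are distinct and not adjacent.  If both images lay in stars,
  -- these would contain, hence equal, f X₀ ∩ f X₁, which would then lie in
  -- f Y and f X₂, making them adjacent; dually for tops with f X₀ ⊕ f X₁.
  incidence : (S : A.𝒢 (suc a)) (U : A.𝒢 (k + 1)) → proj₁ S A.⊆ proj₁ U →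
              ¬ (StarToStar S × TopToStar U) × ¬ (StarToTop S × TopToTop U)
  incidence (S , S-dim) (U , U-dim) S⊆U = both-stars , both-tops
    where
    open A.Pencil (A.pencil (S , S-dim) U U-dim (≤-reflexive (P.sym k+1≡1+k)) S⊆U)
    far : Σ (A.𝒢 k) λ Y → S A.⊆ proj₁ Y × ¬ (proj₁ Y A.≐ proj₁ X₂) × ¬ A.Adj k Y X₂
    far = A.cone-far (S , S-dim) U X₂ S⊆U X₂⊆W S⊈X₂ (proj₂ (proj₂ (A.outside A.whole U V-dim U-dim k+1<n)))
    Y : A.𝒢 k
    Y = proj₁ far
    S⊆Y : S A.⊆ proj₁ Y
    S⊆Y = proj₁ (proj₂ far)
    Y-X₂-far : ¬ A.Adj k Y X₂
    Y-X₂-far = proj₂ (proj₂ (proj₂ far))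
    fY≠fX₂ : ¬ (proj₁ (f Y) B.≐ proj₁ (f X₂))
    fY≠fX₂ = proj₁ (proj₂ (proj₂ far)) ∘ injective Y X₂
    adj₀₁ : B.Adj k′ (f X₀) (f X₁)
    adj₀₁ = adj→adj X₀ X₁ (A.star-adj (S , S-dim) X₀ X₁ S⊆X₀ S⊆X₁ X₀≠X₁)
    F₀ F₁ : B.Subspace
    F₀ = proj₁ (f X₀)
    F₁ = proj₁ (f X₁)
    both-stars : ¬ (StarToStar (S , S-dim) × TopToStar (U , U-dim))
    both-stars ((S₁ , S₁⊆) , (S₂ , S₂⊆)) =
      Y-X₂-far (adj←adj Y X₂ (B.star-adj (F₀ B.∩ F₁ , adj₀₁) (f Y) (f X₂) F⊆fY F⊆fX₂ fY≠fX₂))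
      where
      F⊆fY : (F₀ B.∩ F₁) B.⊆ proj₁ (f Y)
      F⊆fY x x∈F = S₁⊆ Y S⊆Y x
        (B.star-of-adjacent (f X₀) (f X₁) adj₀₁ S₁ (S₁⊆ X₀ S⊆X₀) (S₁⊆ X₁ S⊆X₁) x x∈F)
      F⊆fX₂ : (F₀ B.∩ F₁) B.⊆ proj₁ (f X₂)
      F⊆fX₂ x x∈F = S₂⊆ X₂ X₂⊆W x
        (B.star-of-adjacent (f X₀) (f X₁) adj₀₁ S₂ (S₂⊆ X₀ X₀⊆W) (S₂⊆ X₁ X₁⊆W) x x∈F)
    both-tops : ¬ (StarToTop (S , S-dim) × TopToTop (U , U-dim))
    both-tops (((U₁ , U₁-dim) , U₁⊇) , ((U₂ , U₂-dim) , U₂⊇)) =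
      Y-X₂-far (adj←adj Y X₂
        (B.top-adj (F₀ B.⊕ F₁) (B.sum-dim (f X₀) (f X₁) adj₀₁) (f Y) (f X₂) fY⊆G fX₂⊆G fY≠fX₂))
      where
      top-dim : ∀ U′ → B.HasDim U′ (k′ + 1) → B.HasDim U′ (suc k′)
      top-dim U′ = P.subst (B.HasDim U′) (ℕP.+-comm k′ 1)
      fY⊆G : proj₁ (f Y) B.⊆ (F₀ B.⊕ F₁)
      fY⊆G x x∈ = B.top-of-adjacent (f X₀) (f X₁) adj₀₁ U₁ (top-dim U₁ U₁-dim)
                    (U₁⊇ X₀ S⊆X₀) (U₁⊇ X₁ S⊆X₁) x (U₁⊇ Y S⊆Y x x∈)
      fX₂⊆G : proj₁ (f X₂) B.⊆ (F₀ B.⊕ F₁)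
      fX₂⊆G x x∈ = B.top-of-adjacent (f X₀) (f X₁) adj₀₁ U₂ (top-dim U₂ U₂-dim)
                     (U₂⊇ X₀ X₀⊆W) (U₂⊇ X₁ X₁⊆W) x (U₂⊇ X₂ X₂⊆W x x∈)

  star-fixes-top : (S : A.𝒢 (suc a)) (U : A.𝒢 (k + 1)) → proj₁ S A.⊆ proj₁ U →
                   (StarToStar S → TopToTop U) × (StarToTop S → TopToStar U)
  star-fixes-top S U S⊆U =
    (λ s→s → Sum.[ (λ u→s → ⊥-elim (proj₁ clash (s→s , u→s))) , id ]′ (top-image U)) ,
    (λ s→t → Sum.[ id , (λ u→t → ⊥-elim (proj₂ clash (s→t , u→t))) ]′ (top-image U))
    where clash = incidence S U S⊆U

  top-fixes-star : (S : A.𝒢 (suc a)) (U : A.𝒢 (k + 1)) → proj₁ S A.⊆ proj₁ U →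
                   (TopToStar U → StarToTop S) × (TopToTop U → StarToStar S)
  top-fixes-star S U S⊆U =
    (λ u→s → Sum.[ (λ s→s → ⊥-elim (proj₁ clash (s→s , u→s))) , id ]′ (star-image S)) ,
    (λ u→t → Sum.[ id , (λ s→t → ⊥-elim (proj₂ clash (s→t , u→t))) ]′ (star-image S))
    where clash = incidence S U S⊆U

  Same : A.𝒢 (suc a) → A.𝒢 (suc a) → Set (lsuc (A.ℓs ⊔ B.ℓs))
  Same S₁ S₂ = (StarToStar S₁ → StarToStar S₂) × (StarToTop S₁ → StarToTop S₂)

  same-trans : ∀ {S₁ S₂ S₃} → Same S₁ S₂ → Same S₂ S₃ → Same S₁ S₃
  same-trans (s₁₂ , t₁₂) (s₂₃ , t₂₃) = s₂₃ ∘ s₁₂ , t₂₃ ∘ t₁₂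

  same-in-top : (U : A.𝒢 (k + 1)) (S₁ S₂ : A.𝒢 (suc a)) → proj₁ S₁ A.⊆ proj₁ U → proj₁ S₂ A.⊆ proj₁ U →
                Same S₁ S₂
  same-in-top U S₁ S₂ S₁⊆U S₂⊆U =
    proj₂ (top-fixes-star S₂ U S₂⊆U) ∘ proj₁ (star-fixes-top S₁ U S₁⊆U) ,
    proj₁ (top-fixes-star S₂ U S₂⊆U) ∘ proj₂ (star-fixes-top S₁ U S₁⊆U)

  top-over : ∀ {t} → t ≤ k → (g : Fin t → Carrierᴹ) → Σ (A.𝒢 (k + 1)) λ U → A.Span g A.⊆ proj₁ U
  top-over t≤k g = A.covering-subspace A.whole (k + 1) V-dim g (λ _ → _) (≤-trans t≤k (m≤m+n k 1)) (<⇒≤ k+1<n)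

  span𝒢 : (w : Fin (suc a) → Carrierᴹ) → A.LinIndep w → A.𝒢 (suc a)
  span𝒢 w ind = A.Span w , A.span-dim w ind

  -- Replacing one vector w p by s keeps the kind: the old and the new span
  -- both lie in a top over the k vectors s, w.
  exchange-same : (w : Fin (suc a) → Carrierᴹ) (ind : A.LinIndep w) (p : Fin (suc a)) (s : Carrierᴹ)
                  (ind′ : A.LinIndep (insertAt (w ∘ punchIn p) p s)) →
                  Same (span𝒢 w ind) (span𝒢 (insertAt (w ∘ punchIn p) p s) ind′)
  exchange-same w ind p s ind′ = same-in-top U (span𝒢 w ind) (span𝒢 w′ ind′)
    (A.span⊆ w (proj₁ U) w∈U) (A.span⊆ w′ (proj₁ U) (A.insertAt-∈ (proj₁ U) p (w∈U ∘ punchIn p) s∈U))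
    where
    w′ = insertAt (w ∘ punchIn p) p s
    covering : Σ (A.𝒢 (k + 1)) λ U → A.Span (s ∷ w) A.⊆ proj₁ U
    covering = top-over ≤-refl (s ∷ w)
    U = proj₁ covering
    w∈U : ∀ i → proj₁ U A.∋ w i
    w∈U i = proj₂ covering _ (A.span∋ (s ∷ w) (suc i))
    s∈U : proj₁ U A.∋ s
    s∈U = proj₂ covering _ (A.span∋ (s ∷ w) zero)

  -- Replacing the vectors of an independent family w by vectors of S, from
  -- the last position down, each time by one outside the span of the others,
  -- links the star of Span w to that of S.  Invariant: w i ∈ S for i ≥ j.
  chain : (S : A.𝒢 (suc a)) (j : ℕ) → j ≤ suc a → (w : Fin (suc a) → Carrierᴹ) (ind : A.LinIndep w) →
          (∀ i → j ≤ toℕ i → proj₁ S A.∋ w i) → Same (span𝒢 w ind) S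
  chain (S , S-dim) zero _ w ind w∈S =
    same-in-top U (span𝒢 w ind) (S , S-dim) (λ x → S⊆U x ∘ A.span⊆ w S (λ i → w∈S i z≤n) x) S⊆U
    where
    covering : Σ (A.𝒢 (k + 1)) λ U → A.Span (A.basis S S-dim) A.⊆ proj₁ U
    covering = top-over (n≤1+n (suc a)) (A.basis S S-dim)
    U = proj₁ covering
    S⊆U : S A.⊆ proj₁ U
    S⊆U x x∈S = proj₂ covering x (A.basis-spans S S-dim x x∈S)
  chain (S , S-dim) (suc j) j<1+a w ind w∈S =
    exchange (A.outside S (A.Span (w ∘ punchIn p)) S-dim (A.span-dim (w ∘ punchIn p) (A.indep-remove p {w} ind)) (n<1+n a))
    where
    p = fromℕ< j<1+a
    exchange : (Σ Carrierᴹ λ s → S A.∋ s × ¬ (A.Span (w ∘ punchIn p) A.∋ s)) → Same (span𝒢 w ind) (S , S-dim)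
    exchange (s , s∈S , s∉) =
      same-trans {span𝒢 w ind} {span𝒢 w′ ind′} {S , S-dim}
        (exchange-same w ind p s ind′) (chain (S , S-dim) j (<⇒≤ j<1+a) w′ ind′ w′∈S)
      where
      w′ = insertAt (w ∘ punchIn p) p s
      ind′ : A.LinIndep w′
      ind′ = A.indep-insertAt p {w ∘ punchIn p} (A.indep-remove p {w} ind) s∉
      w′∈S : ∀ i → j ≤ toℕ i → S A.∋ insertAt (w ∘ punchIn p) p s i
      w′∈S i j≤i with punchIn-cover p i
      ... | inj₁ P.refl = A.resp S (≈ᴹ-reflexive (P.sym (insertAt-lookup _ p s))) s∈S
      ... | inj₂ (i′ , P.refl) =
        A.resp S (≈ᴹ-reflexive (P.sym (insertAt-punchIn _ p s i′))) (w∈S (punchIn p i′) (≤∧≢⇒< j≤i j≢))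
        where
        j≢ : j ≢ toℕ (punchIn p i′)
        j≢ j≡ = punchInᵢ≢i p i′ (toℕ-injective (P.trans (P.sym j≡) (P.sym (toℕ-fromℕ< j<1+a))))

  reference : Σ (Fin (suc a) → Carrierᴹ) λ u → (∀ i → A.whole A.∋ u i) × A.LinIndep u
  reference = A.indep-family A.whole (suc a) V-dim (≤-trans (m≤n+m (suc a) 3) k+2≤n)

  w₀ : Fin (suc a) → Carrierᴹ
  w₀ = proj₁ reference

  S₀ : A.𝒢 (suc a)
  S₀ = span𝒢 w₀ (proj₂ (proj₂ reference))

  same-as-S₀ : ∀ S → Same S₀ S
  same-as-S₀ S = chain S (suc a) ≤-refl w₀ (proj₂ (proj₂ reference)) (λ i 1+a≤i → ⊥-elim (<⇒≱ (toℕ<n i) 1+a≤i))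

  top-kind : ∀ U → (StarToStar S₀ → TopToTop U) × (StarToTop S₀ → TopToStar U)
  top-kind U = proj₁ fixes ∘ proj₁ same , proj₂ fixes ∘ proj₂ same
    where
    S = star-in-top U
    fixes : (StarToStar (proj₁ S) → TopToTop U) × (StarToTop (proj₁ S) → TopToStar U)
    fixes = star-fixes-top (proj₁ S) U (proj₂ S)
    same : Same S₀ (proj₁ S)
    same = same-as-S₀ (proj₁ S)

  -- The kind of S₀ decides between (A) and (B); incidence of S₀ with a top
  -- over it excludes both holding.
  dichotomy : (CaseA R V R′ V′ k k′ f ⊎ CaseB R V R′ V′ k k′ f) ×
              ¬ (CaseA R V R′ V′ k k′ f × CaseB R V R′ V′ k k′ f)
  dichotomy = Sum.map case-A case-B (star-image S₀) , exclusive
    where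
    case-A : StarToStar S₀ → CaseA R V R′ V′ k k′ f
    case-A s→s = (λ S → proj₁ (same-as-S₀ S) s→s) , (λ U → proj₁ (top-kind U) s→s)
    case-B : StarToTop S₀ → CaseB R V R′ V′ k k′ f
    case-B s→t = (λ S → proj₂ (same-as-S₀ S) s→t) , (λ U → proj₂ (top-kind U) s→t)
    U₀ : Σ (A.𝒢 (k + 1)) λ U → A.Span w₀ A.⊆ proj₁ U
    U₀ = top-over (n≤1+n _) w₀
    exclusive : ¬ (CaseA R V R′ V′ k k′ f × CaseB R V R′ V′ k k′ f)
    exclusive ((stars→stars , _) , (_ , tops→stars)) =
      proj₁ (incidence S₀ (proj₁ U₀) (proj₂ U₀)) (stars→stars S₀ , tops→stars (proj₁ U₀))

proposition3p2 : (∀ {a : Level} → ExcludedMiddle a) →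
    ∀ {c ℓ m ℓm c' ℓ' m' ℓm' : Level}
    (R : DivisionRing c ℓ) (V : LeftModule (DivisionRing.ring R) m ℓm)
    (R' : DivisionRing c' ℓ') (V' : LeftModule (DivisionRing.ring R') m' ℓm')
    (n n' k k' : ℕ) →
    LinAlg.DimIs R V n → LinAlg.DimIs R' V' n' →
    2 ≤ k → k + 2 ≤ n → 2 ≤ k' → k' + 2 ≤ n' →
    (f : LinAlg.𝒢 R V k → LinAlg.𝒢 R' V' k') →
    IsEmbedding R V R' V' k k' f →
    (CaseA R V R' V' k k' f ⊎ CaseB R V R' V' k k' f)
      × ¬ (CaseA R V R' V' k k' f × CaseB R V R' V' k k' f)
proposition3p2 em R V R' V' n n' (suc (suc a)) (suc (suc b)) V-dim _ (s≤s (s≤s _)) k+2≤n (s≤s (s≤s _)) _ f emb =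
  Embedding.dichotomy em R V R' V' n a b V-dim (P.subst (_≤ n) (ℕP.+-comm (suc (suc a)) 2) k+2≤n) f emb
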